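{- For every integer $n\ge 1$, $$m(n)\le B(n):=1+\sum_{d\mid n}\bigl|\mathrm{cycles}^{(1)}(d)\bigr|\,(d+n-2).$$
   Context: Let $n\ge1$ and $[n]=\{1,\dots,n\}$. A permutation $\pi\in S_n$ is identified with its one-line word $\pi(1)\pi(2)\cdots\pi(n)$. Let $\sigma\in S_n$ be the cycle $\sigma(i)=i+1$ for $i<n$, $\sigma(n)=1$; values and positions are taken modulo $n$ with representatives in $[n]$. For $\pi\in S_n$ let $\mathrm{inc}(\pi)=\{\sigma^k\circ\pi: 0\le k\le n-1\}$ (the permutations obtained from $\pi$ by adding a constant to every value modulo $n$), and let $\mathcal{R}_2$ be the equivalence relation $\pi\,\mathcal{R}_2\,\pi'\iff\pi'\in\mathrm{inc}(\pi)$; it has $(n-1)!$ classes. A word $u$ over $[n]$ is a universal word for $\mathcal{R}_2$ if for every $\pi\in S_n$ some contiguous factor $u(i)u(i+1)\cdots u(i+n-1)$ of $u$ equals the one-line word of some element of $\mathrm{inc}(\pi)$. $m(n)$ denotes the minimal length of a universal word for $\mathcal{R}_2$. The map $f(\mathrm{inc}(\pi))=\mathrm{inc}(\pi\circ\sigma)$ is a well-defined permutation of the set of $\mathcal{R}_2$-classes (on words, $\pi\circ\sigma=\pi(2)\cdots\pi(n)\pi(1)$). A 1-cycle is an orbit of $f$ (equivalently a cycle of weight-1 transitions in the paper's transition graph $H_n$ on the classes; a class fixed by $f$ is a 1-cycle of length 1). $\mathrm{cycles}^{(1)}(d)$ denotes the set of 1-cycles consisting of exactly $d$ classes. -}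

module Defs where

open import Data.Bool using (Bool; true; false; _∧_; not; if_then_else_)
open import Data.Nat using (ℕ; zero; suc; _+_; _*_; _∸_; _<_; _≤_; _<ᵇ_; _≡ᵇ_)
open import Data.Nat.DivMod using (_mod_)
open import Data.Nat.Divisibility using (_∣?_)
open import Data.Fin using (Fin; toℕ; _≟_)
open import Data.List using (List; []; _∷_; [_]; _++_; map; concatMap; allFin; filterᵇ; length; upTo; take; drop)
open import Data.Bool.ListAction using (any; all)
open import Data.Nat.ListAction using (sum)
open import Data.List.Relation.Unary.Unique.Propositional using (Unique)
open import Data.Product using (∃; _×_)
open import Relation.Nullary using (does)
open import Relation.Binary.PropositionalEquality using (_≡_)
import Data.List.Properties as LP

-- Values [n] = {1..n} are represented by Fin n = {0..n-1} (shift by one).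
-- A word over [n] is a List (Fin n); a permutation is identified with its
-- one-line word, i.e. a word of length n with pairwise distinct letters.

Word : ℕ → Set
Word n = List (Fin n)

shift : ∀ {n} → ℕ → Fin n → Fin n
shift {suc m} k i = (toℕ i + k) mod (suc m)

-- the word of σ^k ∘ π
shiftWord : ∀ {n} → ℕ → Word n → Word n
shiftWord k = map (shift k)

_==_ : ∀ {n} → Word n → Word n → Bool
u == v = does (LP.≡-dec _≟_ u v)

distinctᵇ : ∀ {n} → Word n → Bool
distinctᵇ [] = true
distinctᵇ (x ∷ xs) = not (any (λ y → does (x ≟ y)) xs) ∧ distinctᵇ xs

allWords : (n k : ℕ) → List (Word n)
allWords n zero = [ [] ]
allWords n (suc k) = concatMap (λ x → map (x ∷_) (allWords n k)) (allFin n)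

perms : (n : ℕ) → List (Word n)
perms n = filterᵇ distinctᵇ (allWords n n)

-- canonical representative of inc(π): the unique element with first value 1
-- (here: 0), obtained by adding n - π(1) to every value
canon : ∀ {n} → Word n → Word n
canon {n} [] = []
canon {n} (x ∷ xs) = shiftWord (n ∸ toℕ x) (x ∷ xs)

isCanonᵇ : ∀ {n} → Word n → Bool
isCanonᵇ [] = false
isCanonᵇ (x ∷ _) = toℕ x ≡ᵇ 0

-- π ∘ σ on words: π(2)…π(n)π(1)
rotate : ∀ {n} → Word n → Word n
rotate [] = []
rotate (x ∷ xs) = xs ++ [ x ]

-- the map f on classes, acting on canonical representatives
fmap : ∀ {n} → Word n → Word n
fmap w = canon (rotate w)

fpow : ∀ {n} → ℕ → Word n → Word n
fpow zero w = w
fpow (suc k) w = fmap (fpow k w)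

lexLeq : ∀ {n} → Word n → Word n → Bool
lexLeq [] _ = true
lexLeq (x ∷ xs) [] = false
lexLeq (x ∷ xs) (y ∷ ys) =
  if toℕ x <ᵇ toℕ y then true else (if toℕ x ≡ᵇ toℕ y then lexLeq xs ys else false)

-- c (canonical rep of a class) lies in an f-orbit of exactly d classes and is
-- the lexicographically least canonical representative in that orbit
-- (so each 1-cycle of size d is counted exactly once)
cycleLeaderᵇ : ∀ {n} → ℕ → Word n → Bool
cycleLeaderᵇ d c =
  isCanonᵇ c ∧ (fpow d c == c)
  ∧ all (λ j → not (fpow (suc j) c == c)) (upTo (d ∸ 1))
  ∧ all (λ j → lexLeq c (fpow (suc j) c)) (upTo (d ∸ 1))

cycles1 : ℕ → ℕ → ℕ
cycles1 n d = length (filterᵇ (cycleLeaderᵇ d) (perms n))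

divisors : ℕ → List ℕ
divisors n = filterᵇ (λ d → does (d ∣? n)) (map suc (upTo n))

B : ℕ → ℕ
B n = 1 + sum (map (λ d → cycles1 n d * (d + n ∸ 2)) (divisors n))

-- u is a universal word for R_2: every π ∈ S_n has some element of inc(π)
-- occurring as a contiguous factor u(i)…u(i+n-1)
Universal : (n : ℕ) → Word n → Set
Universal n u =
  (π : Word n) → length π ≡ n → Unique π →
  ∃ λ i → ∃ λ k → k < n × take n (drop i u) ≡ shiftWord k π

-- Every class has exactly one canonical representative (first value 1), and f acts on
-- them as rotate-then-renormalise, so f^k (canon π) is the class of the k-th rotation
-- of π; in particular f^n = id and every cycle of f has a length d dividing n. For each
-- cycle with d classes take its lexicographically least canonical representative c and
-- the block c ++ c(1)…c(d-1): its n-letter windows are the rotations c, c∘σ, …, c∘σ^(d-1),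
-- whose classes are exactly the d classes of the cycle. Gluing all blocks, each shifted
-- to begin with the last letter written so far, saves one letter per block, which gives
-- a universal word of length 1 + Σ_{d ∣ n} |cycles⁽¹⁾(d)| (d + n - 2).

module Submission where

open import Defs
open import Data.Nat using (ℕ; _≤_)
open import Data.List using (length)
open import Data.Product using (∃; _×_)

open import Data.Nat using (zero; suc; _<ᵇ_; _≡ᵇ_; _⊓_; _+_; _*_; _∸_; _<_; z≤n; s≤s; NonZero)
open import Data.Nat.Properties
open import Data.Nat.DivMod
open import Data.Nat.Divisibility using (_∣_; _∣?_; m%n≡0⇒n∣m)
open import Data.Nat.ListAction using (sum)
open import Data.Nat.ListAction.Properties using (sum-++)
open import Data.Fin as Fin using (Fin; toℕ)
open import Data.Fin.Properties using (toℕ-injective; toℕ<n; toℕ-fromℕ<)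
import Data.Fin.Properties as FinP
open import Data.List using (List; []; _∷_; [_]; _++_; map; take; drop; upTo; concatMap; allFin; filterᵇ)
open import Data.List.Properties hiding (sum-++)
open import Data.List.Membership.Propositional using (_∈_)
open import Data.List.Membership.Propositional.Properties
open import Data.List.Relation.Unary.Any using (here; there)
open import Data.List.Relation.Unary.Any.Properties using (any⁻)
import Data.List.Relation.Unary.Any as Any
import Data.List.Relation.Unary.All as All
open import Data.List.Relation.Unary.All.Properties using (All¬⇒¬Any; all⁻; applyUpTo⁺₁)
open import Data.List.Relation.Unary.AllPairs using ([]; _∷_)
open import Data.List.Relation.Unary.Unique.Propositional using (Unique)
import Data.List.Relation.Unary.Unique.Propositional.Properties as Unique
import Data.List.Relation.Binary.Permutation.Setoid.Properties as Perm
open import Data.List.Relation.Binary.Lex.Core using (base; halt; this; next)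
import Data.List.Relation.Binary.Lex.NonStrict as Lex
import Data.List.Extrema
open import Data.Bool using (true; false; T; not; _∧_)
open import Data.Bool.Properties using (T-∧)
open import Data.Bool.ListAction using (any)
open import Data.Product using (_,_; proj₁; proj₂)
open import Data.Sum using (_⊎_; inj₁; inj₂)
open import Data.Empty using (⊥-elim)
open import Data.Unit using (tt)
open import Function using (_∘_; id; Equivalence)
open import Relation.Binary.Bundles using (DecTotalOrder)
open import Relation.Binary.PropositionalEquality hiding ([_])
open import Relation.Nullary using (¬_; yes; no; does)
open import Relation.Nullary.Decidable using (toWitness; fromWitness; fromWitnessFalse; isYes≗does; T?)
open import Relation.Unary using (Decidable)

private
  variable
    A : Set

drop-++ˡ : ∀ j (xs ys : List A) → j ≤ length xs → drop j (xs ++ ys) ≡ drop j xs ++ ys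
drop-++ˡ zero xs ys _ = refl
drop-++ˡ (suc j) (x ∷ xs) ys (s≤s j≤) = drop-++ˡ j xs ys j≤

take-++ˡ : ∀ k (xs ys : List A) → k ≤ length xs → take k (xs ++ ys) ≡ take k xs
take-++ˡ zero xs ys _ = refl
take-++ˡ (suc k) (x ∷ xs) ys (s≤s k≤) = cong (x ∷_) (take-++ˡ k xs ys k≤)

take-++ʳ : ∀ k (xs ys : List A) → length xs ≤ k → take k (xs ++ ys) ≡ xs ++ take (k ∸ length xs) ys
take-++ʳ k [] ys _ = refl
take-++ʳ (suc k) (x ∷ xs) ys (s≤s ≤k) = cong (x ∷_) (take-++ʳ k xs ys ≤k)

take-drop-++ˡ : ∀ j k (xs ys : List A) → j + k ≤ length xs → take k (drop j (xs ++ ys)) ≡ take k (drop j xs)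
take-drop-++ˡ zero k xs ys k≤ = take-++ˡ k xs ys k≤
take-drop-++ˡ (suc j) k (x ∷ xs) ys (s≤s j+k≤) = take-drop-++ˡ j k xs ys j+k≤

drop-length-++ : ∀ (xs ys : List A) → drop (length xs) (xs ++ ys) ≡ ys
drop-length-++ [] ys = refl
drop-length-++ (x ∷ xs) ys = drop-length-++ xs ys

drop-∷-take-∷ʳ : ∀ k (xs : List A) → k < length xs →
  ∃ λ x → drop k xs ≡ x ∷ drop (suc k) xs × take (suc k) xs ≡ take k xs ++ [ x ]
drop-∷-take-∷ʳ zero (x ∷ xs) _ = x , refl , refl
drop-∷-take-∷ʳ (suc k) (y ∷ xs) (s≤s k<) with drop-∷-take-∷ʳ k xs k<
... | x , drop≡ , take≡ = x , drop≡ , cong (y ∷_) take≡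

rotateBy : ℕ → List A → List A
rotateBy k xs = drop k xs ++ take k xs

length-rotateBy : ∀ k (xs : List A) → length (rotateBy k xs) ≡ length xs
length-rotateBy k xs = begin
  length (drop k xs ++ take k xs)         ≡⟨ length-++ (drop k xs) ⟩
  length (drop k xs) + length (take k xs) ≡⟨ +-comm (length (drop k xs)) _ ⟩
  length (take k xs) + length (drop k xs) ≡⟨ length-++ (take k xs) ⟨
  length (take k xs ++ drop k xs)         ≡⟨ cong length (take++drop≡id k xs) ⟩
  length xs                               ∎
  where open ≡-Reasoning

rotateBy-length : ∀ (xs : List A) → rotateBy (length xs) xs ≡ xs
rotateBy-length xs = cong₂ _++_ (drop-all (length xs) xs ≤-refl) (take-all (length xs) xs ≤-refl)

Unique-rotateBy : ∀ k {xs : List A} → Unique xs → Unique (rotateBy k xs)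
Unique-rotateBy {A} k {xs} u =
  Perm.Unique-resp-↭ (setoid A) (Perm.++-comm (setoid A) (take k xs) (drop k xs))
    (subst Unique (sym (take++drop≡id k xs)) u)

take-length-drop-++ : ∀ j (xs ys : List A) → j ≤ length xs →
  take (length xs) (drop j (xs ++ ys)) ≡ drop j xs ++ take j ys
take-length-drop-++ j xs ys j≤ = begin
  take (length xs) (drop j (xs ++ ys))                      ≡⟨ cong (take (length xs)) (drop-++ˡ j xs ys j≤) ⟩
  take (length xs) (drop j xs ++ ys)                        ≡⟨ take-++ʳ (length xs) (drop j xs) ys (≤-trans (≤-reflexive (length-drop j xs)) (m∸n≤m (length xs) j)) ⟩
  drop j xs ++ take (length xs ∸ length (drop j xs)) ys     ≡⟨ cong (λ l → drop j xs ++ take (length xs ∸ l) ys) (length-drop j xs) ⟩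
  drop j xs ++ take (length xs ∸ (length xs ∸ j)) ys        ≡⟨ cong (λ l → drop j xs ++ take l ys) (m∸[m∸n]≡n j≤) ⟩
  drop j xs ++ take j ys                                    ∎
  where open ≡-Reasoning

sum-map-≤ : ∀ (f : A → ℕ) K (xs : List A) → (∀ x → x ∈ xs → f x ≤ K) → sum (map f xs) ≤ length xs * K
sum-map-≤ f K [] _ = z≤n
sum-map-≤ f K (x ∷ xs) f≤K = +-mono-≤ (f≤K x (here refl)) (sum-map-≤ f K xs (λ y y∈ → f≤K y (there y∈)))

least-below : ∀ {P : ℕ → Set} → Decidable P → ∀ k →
  (∃ λ d → d < k × P d × (∀ j → j < d → ¬ P j)) ⊎ (∀ j → j < k → ¬ P j)
least-below P? zero = inj₂ (λ _ ())
least-below {P} P? (suc k) with least-below P? k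
... | inj₁ (d , d<k , Pd , least) = inj₁ (d , m<n⇒m<1+n d<k , Pd , least)
... | inj₂ none with P? k
...   | yes Pk = inj₁ (k , n<1+n k , Pk , none)
...   | no ¬Pk = inj₂ λ j j<1+k → case (m<1+n⇒m<n∨m≡n j<1+k)
  where
  case : ∀ {j} → j < k ⊎ j ≡ k → ¬ P j
  case (inj₁ j<k) = none _ j<k
  case (inj₂ refl) = ¬Pk

[m%d+n]%d≡[m+n]%d : ∀ m n d .{{_ : NonZero d}} → (m % d + n) % d ≡ (m + n) % d
[m%d+n]%d≡[m+n]%d m n d = begin
  (m % d + n) % d            ≡⟨ %-distribˡ-+ (m % d) n d ⟩
  (m % d % d + n % d) % d    ≡⟨ cong (λ r → (r + n % d) % d) (m%n%n≡m%n m d) ⟩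
  (m % d + n % d) % d        ≡⟨ %-distribˡ-+ m n d ⟨
  (m + n) % d                ∎
  where open ≡-Reasoning

[m+n%d]%d≡[m+n]%d : ∀ m n d .{{_ : NonZero d}} → (m + n % d) % d ≡ (m + n) % d
[m+n%d]%d≡[m+n]%d m n d = begin
  (m + n % d) % d   ≡⟨ cong (_% d) (+-comm m (n % d)) ⟩
  (n % d + m) % d   ≡⟨ [m%d+n]%d≡[m+n]%d n m d ⟩
  (n + m) % d       ≡⟨ cong (_% d) (+-comm n m) ⟩
  (m + n) % d       ∎
  where open ≡-Reasoning

module _ {n : ℕ} where

  _≼_ : Word n → Word n → Set
  _≼_ = Lex.Lex-≤ _≡_ Fin._≤_

  ≼⇒lexLeq : ∀ {u v : Word n} → u ≼ v → T (lexLeq u v)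
  ≼⇒lexLeq (base _) = tt
  ≼⇒lexLeq halt = tt
  ≼⇒lexLeq {x ∷ _} {y ∷ _} (this (x≤y , x≢y)) with toℕ x <ᵇ toℕ y | <⇒<ᵇ (FinP.≤∧≢⇒< x≤y x≢y)
  ... | true | _ = tt
  ≼⇒lexLeq {x ∷ _} (next refl xs≼ys) with toℕ x <ᵇ toℕ x | toℕ x ≡ᵇ toℕ x | ≡⇒≡ᵇ (toℕ x) (toℕ x) refl
  ... | true  | _    | _ = tt
  ... | false | true | _ = ≼⇒lexLeq xs≼ys

≼-decTotalOrder : ℕ → DecTotalOrder _ _ _
≼-decTotalOrder n = Lex.≤-decTotalOrder (FinP.≤-decTotalOrder n)

Unique⇒distinctᵇ : ∀ {n} {w : Word n} → Unique w → T (distinctᵇ w)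
Unique⇒distinctᵇ [] = tt
Unique⇒distinctᵇ {w = x ∷ xs} (x∉xs ∷ u) = Equivalence.from T-∧ (not-member , Unique⇒distinctᵇ u)
  where
  not-member : T (not (any (λ y → does (x Fin.≟ y)) xs))
  not-member with any (λ y → does (x Fin.≟ y)) xs in found
  ... | false = tt
  ... | true = All¬⇒¬Any x∉xs (Any.map (λ {y} t → toWitness (subst T (sym (isYes≗does (x Fin.≟ y))) t))
                                        (any⁻ _ xs (subst T (sym found) tt)))

∈-allWords : ∀ {n} k (w : Word n) → length w ≡ k → w ∈ allWords n k
∈-allWords zero [] _ = here refl
∈-allWords {n} (suc k) (x ∷ w) len = ∈-concat⁺′ (∈-map⁺ (x ∷_) (∈-allWords k w (suc-injective len)))
  (∈-map⁺ (λ y → map (y ∷_) (allWords n k)) (∈-allFin x))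

allWords-length : ∀ {n} k {w : Word n} → w ∈ allWords n k → length w ≡ k
allWords-length zero (here refl) = refl
allWords-length {n} (suc k) w∈ with ∈-concat⁻′ (map (λ y → map (y ∷_) (allWords n k)) (allFin n)) w∈
... | vs , w∈vs , vs∈ with ∈-map⁻ (λ y → map (y ∷_) (allWords n k)) vs∈
... | x , _ , refl with ∈-map⁻ (x ∷_) w∈vs
... | w′ , w′∈ , refl = cong suc (allWords-length k w′∈)

∈-perms : ∀ {n} (w : Word n) → length w ≡ n → Unique w → w ∈ perms n
∈-perms {n} w len u = ∈-filter⁺ (T? ∘ distinctᵇ) (∈-allWords n w len) (Unique⇒distinctᵇ u)

perms-length : ∀ {n} {w : Word n} → w ∈ perms n → length w ≡ n
perms-length {n} w∈ = allWords-length n (proj₁ (∈-filter⁻ (T? ∘ distinctᵇ) w∈))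

∈-divisors : ∀ {n} d → suc d ∣ n → d < n → suc d ∈ divisors n
∈-divisors {n} d D∣n d<n = ∈-filter⁺ (T? ∘ λ D → does (D ∣? n)) (∈-map⁺ suc (∈-upTo⁺ d<n))
  (subst T (isYes≗does (suc d ∣? n)) (fromWitness D∣n))

∈-divisors⁻ : ∀ {n D} → D ∈ divisors n → ∃ λ d → D ≡ suc d × d < n
∈-divisors⁻ {n} D∈ with ∈-map⁻ suc (proj₁ (∈-filter⁻ (T? ∘ λ D → does (D ∣? n)) {xs = map suc (upTo n)} D∈))
... | d , d∈ , refl = d , refl , ∈-upTo⁻ d∈

T-== : ∀ {n} {u v : Word n} → u ≡ v → T (u == v)
T-== {u = u} {v} u≡v = subst T (isYes≗does (≡-dec Fin._≟_ u v)) (fromWitness u≡v)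

T-not-== : ∀ {n} {u v : Word n} → u ≢ v → T (not (u == v))
T-not-== {u = u} {v} u≢v = subst (T ∘ not) (isYes≗does (≡-dec Fin._≟_ u v)) (fromWitnessFalse u≢v)

isCanonᵇ⇒ : ∀ {m} (c : Word (suc m)) → T (isCanonᵇ c) → ∃ λ cs → c ≡ Fin.zero ∷ cs
isCanonᵇ⇒ [] ()
isCanonᵇ⇒ (Fin.zero ∷ cs) _ = cs , refl
isCanonᵇ⇒ (Fin.suc _ ∷ _) ()

-- Shifts and canonical representatives

module _ {m : ℕ} where

  private
    n : ℕ
    n = suc m

  toℕ-shift : ∀ k (i : Fin n) → toℕ (shift k i) ≡ (toℕ i + k) % n
  toℕ-shift k i = toℕ-fromℕ< (m%n<n (toℕ i + k) n)

  shift-≡ : ∀ a b (i j : Fin n) → (toℕ i + a) % n ≡ (toℕ j + b) % n → shift a i ≡ shift b j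
  shift-≡ a b i j eq = toℕ-injective (trans (toℕ-shift a i) (trans eq (sym (toℕ-shift b j))))

  shift-shift : ∀ a b (y : Fin n) → shift a (shift b y) ≡ shift (b + a) y
  shift-shift a b y = shift-≡ a (b + a) (shift b y) y (begin
    (toℕ (shift b y) + a) % n   ≡⟨ cong (λ r → (r + a) % n) (toℕ-shift b y) ⟩
    ((toℕ y + b) % n + a) % n   ≡⟨ [m%d+n]%d≡[m+n]%d (toℕ y + b) a n ⟩
    (toℕ y + b + a) % n         ≡⟨ cong (_% n) (+-assoc (toℕ y) b a) ⟩
    (toℕ y + (b + a)) % n       ∎)
    where open ≡-Reasoning

  shift-comm : ∀ a b (y : Fin n) → shift a (shift b y) ≡ shift b (shift a y)
  shift-comm a b y = trans (shift-shift a b y) (trans (cong (λ k → shift k y) (+-comm b a)) (sym (shift-shift b a y)))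

  shift-% : ∀ k (y : Fin n) → shift (k % n) y ≡ shift k y
  shift-% k y = shift-≡ (k % n) k y y ([m+n%d]%d≡[m+n]%d (toℕ y) k n)

  shift-0 : ∀ (y : Fin n) → shift 0 y ≡ y
  shift-0 y = toℕ-injective (begin
    toℕ (shift 0 y)     ≡⟨ toℕ-shift 0 y ⟩
    (toℕ y + 0) % n     ≡⟨ cong (_% n) (+-identityʳ (toℕ y)) ⟩
    toℕ y % n           ≡⟨ m<n⇒m%n≡m (toℕ<n y) ⟩
    toℕ y               ∎)
    where open ≡-Reasoning

  shift-n : ∀ (y : Fin n) → shift n y ≡ y
  shift-n y = trans (sym (shift-% n y)) (trans (cong (λ k → shift k y) (n%n≡0 n)) (shift-0 y))

  shift-toℕ : ∀ (a : Fin n) → shift (toℕ a) Fin.zero ≡ a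
  shift-toℕ a = toℕ-injective (trans (toℕ-shift (toℕ a) Fin.zero) (m<n⇒m%n≡m (toℕ<n a)))

  shift-to-zero : ∀ (x : Fin n) → shift (n ∸ toℕ x) x ≡ Fin.zero
  shift-to-zero x = toℕ-injective (begin
    toℕ (shift (n ∸ toℕ x) x)     ≡⟨ toℕ-shift (n ∸ toℕ x) x ⟩
    (toℕ x + (n ∸ toℕ x)) % n     ≡⟨ cong (_% n) (m+[n∸m]≡n (<⇒≤ (toℕ<n x))) ⟩
    n % n                         ≡⟨ n%n≡0 n ⟩
    0                             ∎)
    where open ≡-Reasoning

  -- Any value is a shift of any other, and shifts commute, so two shifts that agree
  -- at one value agree everywhere.
  shift-cong : ∀ {a b} (x : Fin n) → shift a x ≡ shift b x → ∀ y → shift a y ≡ shift b y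
  shift-cong {a} {b} x eq y = begin
    shift a y              ≡⟨ cong (shift a) x↦y ⟨
    shift a (shift t x)    ≡⟨ shift-comm a t x ⟩
    shift t (shift a x)    ≡⟨ cong (shift t) eq ⟩
    shift t (shift b x)    ≡⟨ shift-comm t b x ⟩
    shift b (shift t x)    ≡⟨ cong (shift b) x↦y ⟩
    shift b y              ∎
    where
    open ≡-Reasoning
    t = n ∸ toℕ x + toℕ y
    x↦y : shift t x ≡ y
    x↦y = trans (sym (shift-shift (toℕ y) (n ∸ toℕ x) x)) (trans (cong (shift (toℕ y)) (shift-to-zero x)) (shift-toℕ y))

  shift-inverse : ∀ k (y : Fin n) → shift (n ∸ k % n) (shift k y) ≡ y
  shift-inverse k y = begin
    shift (n ∸ k % n) (shift k y)     ≡⟨ shift-shift (n ∸ k % n) k y ⟩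
    shift (k + (n ∸ k % n)) y         ≡⟨ shift-% (k + (n ∸ k % n)) y ⟨
    shift ((k + (n ∸ k % n)) % n) y   ≡⟨ cong (λ r → shift r y) multiple-of-n ⟩
    shift 0 y                         ≡⟨ shift-0 y ⟩
    y                                 ∎
    where
    open ≡-Reasoning
    multiple-of-n : (k + (n ∸ k % n)) % n ≡ 0
    multiple-of-n = begin
      (k + (n ∸ k % n)) % n       ≡⟨ [m%d+n]%d≡[m+n]%d k (n ∸ k % n) n ⟨
      (k % n + (n ∸ k % n)) % n   ≡⟨ cong (_% n) (m+[n∸m]≡n (m%n≤n k n)) ⟩
      n % n                       ≡⟨ n%n≡0 n ⟩
      0                           ∎

  shift-injective : ∀ k {y z : Fin n} → shift k y ≡ shift k z → y ≡ z
  shift-injective k {y} {z} eq =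
    trans (sym (shift-inverse k y)) (trans (cong (shift (n ∸ k % n)) eq) (shift-inverse k z))

  length-shiftWord : ∀ k (w : Word n) → length (shiftWord k w) ≡ length w
  length-shiftWord k = length-map (shift k)

  shiftWord-shiftWord : ∀ a b (w : Word n) → shiftWord a (shiftWord b w) ≡ shiftWord (b + a) w
  shiftWord-shiftWord a b w = trans (sym (map-∘ w)) (map-cong (shift-shift a b) w)

  shiftWord-n : ∀ (w : Word n) → shiftWord n w ≡ w
  shiftWord-n w = trans (map-cong shift-n w) (map-id w)

  Unique-shiftWord : ∀ k {w : Word n} → Unique w → Unique (shiftWord k w)
  Unique-shiftWord k = Unique.map⁺ (shift-injective k)

  length-canon : ∀ (w : Word n) → length (canon w) ≡ length w
  length-canon [] = refl
  length-canon (x ∷ xs) = length-shiftWord _ (x ∷ xs)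

  Unique-canon : ∀ {w : Word n} → Unique w → Unique (canon w)
  Unique-canon {[]} u = u
  Unique-canon {x ∷ xs} u = Unique-shiftWord _ u

  canon-∷ : ∀ (x : Fin n) xs → canon (x ∷ xs) ≡ Fin.zero ∷ shiftWord (n ∸ toℕ x) xs
  canon-∷ x xs = cong (_∷ shiftWord (n ∸ toℕ x) xs) (shift-to-zero x)

  canon-nonempty : ∀ (w : Word n) → 0 < length w → ∃ λ cs → canon w ≡ Fin.zero ∷ cs
  canon-nonempty (x ∷ xs) _ = shiftWord (n ∸ toℕ x) xs , canon-∷ x xs

  canon-zero∷ : ∀ (xs : Word n) → canon (Fin.zero ∷ xs) ≡ Fin.zero ∷ xs
  canon-zero∷ xs = shiftWord-n (Fin.zero ∷ xs)

  canon-shiftWord : ∀ k (w : Word n) → canon (shiftWord k w) ≡ canon w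
  canon-shiftWord k [] = refl
  canon-shiftWord k (x ∷ xs) =
    trans (shiftWord-shiftWord (n ∸ toℕ (shift k x)) k (x ∷ xs)) (map-cong (shift-cong x both-to-zero) (x ∷ xs))
    where
    both-to-zero : shift (k + (n ∸ toℕ (shift k x))) x ≡ shift (n ∸ toℕ x) x
    both-to-zero = trans (sym (shift-shift _ k x)) (trans (shift-to-zero (shift k x)) (sym (shift-to-zero x)))

  shiftWord-canon : ∀ (x : Fin n) xs → shiftWord (toℕ x) (canon (x ∷ xs)) ≡ x ∷ xs
  shiftWord-canon x xs = begin
    shiftWord (toℕ x) (shiftWord (n ∸ toℕ x) (x ∷ xs)) ≡⟨ shiftWord-shiftWord (toℕ x) (n ∸ toℕ x) (x ∷ xs) ⟩
    shiftWord (n ∸ toℕ x + toℕ x) (x ∷ xs)             ≡⟨ cong (λ k → shiftWord k (x ∷ xs)) (m∸n+n≡m (<⇒≤ (toℕ<n x))) ⟩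
    shiftWord n (x ∷ xs)                               ≡⟨ shiftWord-n (x ∷ xs) ⟩
    x ∷ xs                                             ∎
    where open ≡-Reasoning

  canon-≡⇒shiftWord : ∀ (v w : Word n) → canon v ≡ canon w → ∃ λ k → k < n × v ≡ shiftWord k w
  canon-≡⇒shiftWord [] [] _ = 0 , s≤s z≤n , refl
  canon-≡⇒shiftWord (x ∷ xs) (y ∷ ys) eq = (n ∸ toℕ y + toℕ x) % n , m%n<n (n ∸ toℕ y + toℕ x) n , (begin
    x ∷ xs                                          ≡⟨ shiftWord-canon x xs ⟨
    shiftWord (toℕ x) (canon (x ∷ xs))              ≡⟨ cong (shiftWord (toℕ x)) eq ⟩
    shiftWord (toℕ x) (canon (y ∷ ys))              ≡⟨ shiftWord-shiftWord (toℕ x) (n ∸ toℕ y) (y ∷ ys) ⟩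
    shiftWord (n ∸ toℕ y + toℕ x) (y ∷ ys)          ≡⟨ map-cong (shift-% (n ∸ toℕ y + toℕ x)) (y ∷ ys) ⟨
    shiftWord ((n ∸ toℕ y + toℕ x) % n) (y ∷ ys)    ∎)
    where open ≡-Reasoning

  -- The map f and its cycles

  rotate-shiftWord : ∀ k (w : Word n) → rotate (shiftWord k w) ≡ shiftWord k (rotate w)
  rotate-shiftWord k [] = refl
  rotate-shiftWord k (x ∷ xs) = sym (map-++ (shift k) xs [ x ])

  rotate-rotateBy : ∀ k (w : Word n) → k < length w → rotate (rotateBy k w) ≡ rotateBy (suc k) w
  rotate-rotateBy k w k< with drop-∷-take-∷ʳ k w k<
  ... | x , drop≡ , take≡ rewrite drop≡ | take≡ = ++-assoc (drop (suc k) w) (take k w) [ x ]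

  fmap-canon : ∀ (w : Word n) → fmap (canon w) ≡ fmap w
  fmap-canon [] = refl
  fmap-canon (x ∷ xs) = trans (cong canon (rotate-shiftWord _ (x ∷ xs))) (canon-shiftWord _ (rotate (x ∷ xs)))

  fpow-canon : ∀ k (w : Word n) → k ≤ length w → fpow k (canon w) ≡ canon (rotateBy k w)
  fpow-canon zero w _ = cong canon (sym (++-identityʳ w))
  fpow-canon (suc k) w k< = begin
    fmap (fpow k (canon w))          ≡⟨ cong fmap (fpow-canon k w (<⇒≤ k<)) ⟩
    fmap (canon (rotateBy k w))      ≡⟨ fmap-canon (rotateBy k w) ⟩
    canon (rotate (rotateBy k w))    ≡⟨ cong canon (rotate-rotateBy k w k<) ⟩
    canon (rotateBy (suc k) w)       ∎
    where open ≡-Reasoning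

  fpow-length-canon : ∀ (w : Word n) {l} → length w ≡ l → fpow l (canon w) ≡ canon w
  fpow-length-canon w refl = trans (fpow-canon (length w) w ≤-refl) (cong canon (rotateBy-length w))

  fpow-+ : ∀ a b (w : Word n) → fpow (a + b) w ≡ fpow a (fpow b w)
  fpow-+ zero b w = refl
  fpow-+ (suc a) b w = cong fmap (fpow-+ a b w)

  fpow-comm : ∀ a b (w : Word n) → fpow a (fpow b w) ≡ fpow b (fpow a w)
  fpow-comm a b w = trans (sym (fpow-+ a b w)) (trans (cong (λ k → fpow k w) (+-comm a b)) (fpow-+ b a w))

  fpow-* : ∀ p (w : Word n) → fpow p w ≡ w → ∀ q → fpow (q * p) w ≡ w
  fpow-* p w periodic zero = refl
  fpow-* p w periodic (suc q) = trans (fpow-+ p (q * p) w) (trans (cong (fpow p) (fpow-* p w periodic q)) periodic)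

  fpow-% : ∀ d (w : Word n) → fpow (suc d) w ≡ w → ∀ k → fpow k w ≡ fpow (k % suc d) w
  fpow-% d w periodic k = begin
    fpow k w                                        ≡⟨ cong (λ l → fpow l w) (m≡m%n+[m/n]*n k (suc d)) ⟩
    fpow (k % suc d + k / suc d * suc d) w          ≡⟨ fpow-+ (k % suc d) (k / suc d * suc d) w ⟩
    fpow (k % suc d) (fpow (k / suc d * suc d) w)   ≡⟨ cong (fpow (k % suc d)) (fpow-* (suc d) w periodic (k / suc d)) ⟩
    fpow (k % suc d) w                              ∎
    where open ≡-Reasoning

  fpow-return : ∀ p (w : Word n) → fpow p w ≡ w → ∀ i → i ≤ p → fpow (p ∸ i) (fpow i w) ≡ w
  fpow-return p w periodic i i≤p =
    trans (sym (fpow-+ (p ∸ i) i w)) (trans (cong (λ k → fpow k w) (m∸n+n≡m i≤p)) periodic)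

  record IsLeastPeriod (p : ℕ) (w : Word n) : Set where
    constructor isLeastPeriod
    field
      periodic : fpow p w ≡ w
      aperiodic : ∀ j → suc j < p → fpow (suc j) w ≢ w

  ∃-leastPeriod : ∀ N (w : Word n) → fpow (suc N) w ≡ w → ∃ λ d → d ≤ N × IsLeastPeriod (suc d) w
  ∃-leastPeriod N w periodic with least-below (λ j → ≡-dec Fin._≟_ (fpow (suc j) w) w) (suc N)
  ... | inj₁ (d , d<1+N , periodic-d , least) = d , ≤-pred d<1+N , isLeastPeriod periodic-d λ j 1+j<1+d → least j (≤-pred 1+j<1+d)
  ... | inj₂ none = ⊥-elim (none N (n<1+n N) periodic)

  leastPeriod-∣ : ∀ {d} {w : Word n} → IsLeastPeriod (suc d) w → ∀ N → fpow N w ≡ w → suc d ∣ N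
  leastPeriod-∣ {d} {w} (isLeastPeriod periodic aperiodic) N periodic-N =
    m%n≡0⇒n∣m N (suc d) (remainder-zero (N % suc d) (m%n<n N (suc d)) (trans (sym (fpow-% d w periodic N)) periodic-N))
    where
    remainder-zero : ∀ r → r < suc d → fpow r w ≡ w → r ≡ 0
    remainder-zero zero _ _ = refl
    remainder-zero (suc r) r< periodic-r = ⊥-elim (aperiodic r r< periodic-r)

  fpow-periodic : ∀ p (w : Word n) → fpow p w ≡ w → ∀ i → fpow p (fpow i w) ≡ fpow i w
  fpow-periodic p w periodic i = trans (fpow-comm p i w) (cong (fpow i) periodic)

  leastPeriod-fpow : ∀ {p} {w : Word n} → IsLeastPeriod p w → ∀ i → i ≤ p → IsLeastPeriod p (fpow i w)
  leastPeriod-fpow {p} {w} (isLeastPeriod periodic aperiodic) i i≤p = isLeastPeriod (fpow-periodic p w periodic i) aperiodic-c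
    where
    open ≡-Reasoning
    c = fpow i w
    aperiodic-c : ∀ j → suc j < p → fpow (suc j) c ≢ c
    aperiodic-c j 1+j<p periodic-j = aperiodic j 1+j<p (begin
      fpow (suc j) w                  ≡⟨ cong (fpow (suc j)) (fpow-return p w periodic i i≤p) ⟨
      fpow (suc j) (fpow (p ∸ i) c)   ≡⟨ fpow-comm (suc j) (p ∸ i) c ⟩
      fpow (p ∸ i) (fpow (suc j) c)   ≡⟨ cong (fpow (p ∸ i)) periodic-j ⟩
      fpow (p ∸ i) c                  ≡⟨ fpow-return p w periodic i i≤p ⟩
      w                               ∎)

  private
    module LexMin = Data.List.Extrema (DecTotalOrder.totalOrder (≼-decTotalOrder n))

  orbit : ℕ → Word n → List (Word n)
  orbit p w = map (λ i → fpow i w) (upTo p)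

  ∈-orbit : ∀ d (w : Word n) → fpow (suc d) w ≡ w → ∀ k → fpow k w ∈ orbit (suc d) w
  ∈-orbit d w periodic k = subst (_∈ orbit (suc d) w) (sym (fpow-% d w periodic k))
    (∈-map⁺ (λ i → fpow i w) (∈-upTo⁺ (m%n<n k (suc d))))

  orbit-minimum : ∀ d (w : Word n) → fpow (suc d) w ≡ w → ∃ λ i → i ≤ d × ∀ k → fpow i w ≼ fpow k (fpow i w)
  orbit-minimum d w periodic with ∈-map⁻ (λ i → fpow i w) min∈orbit
    where
    min∈orbit : LexMin.min w (orbit (suc d) w) ∈ orbit (suc d) w
    min∈orbit with LexMin.argmin-sel id w (orbit (suc d) w)
    ... | inj₁ min≡w = subst (_∈ orbit (suc d) w) (sym min≡w) (here refl)
    ... | inj₂ min∈ = min∈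
  ... | i , i∈ , min≡ = i , ≤-pred (∈-upTo⁻ i∈) , minimal
    where
    minimal : ∀ k → fpow i w ≼ fpow k (fpow i w)
    minimal k = subst (_≼ fpow k (fpow i w)) min≡ (All.lookup (LexMin.min≤xs w (orbit (suc d) w))
      (subst (_∈ orbit (suc d) w) (fpow-+ k i w) (∈-orbit d w periodic (k + i))))

  record IsCycleLeader (p : ℕ) (c : Word n) : Set where
    constructor isCycleLeader
    field
      leastPeriod : IsLeastPeriod p c
      lex-minimal : ∀ k → c ≼ fpow k c

  cycleLeader-in-orbit : ∀ {d} {w : Word n} → IsLeastPeriod (suc d) w → ∃ λ i → i ≤ d × IsCycleLeader (suc d) (fpow i w)
  cycleLeader-in-orbit {d} {w} least =
    let i , i≤d , minimal = orbit-minimum d w (IsLeastPeriod.periodic least)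
    in i , i≤d , isCycleLeader (leastPeriod-fpow least i (m≤n⇒m≤1+n i≤d)) minimal

  orbit-return : ∀ {d} {w : Word n} → fpow (suc d) w ≡ w → ∀ i → i ≤ suc d → ∃ λ j → j ≤ d × fpow j (fpow i w) ≡ w
  orbit-return {d} {w} periodic i i≤ =
    (suc d ∸ i) % suc d , ≤-pred (m%n<n (suc d ∸ i) (suc d)) ,
    trans (sym (fpow-% d (fpow i w) (fpow-periodic (suc d) w periodic i) (suc d ∸ i))) (fpow-return (suc d) w periodic i i≤)

  fpow-canon-permutation : ∀ (π : Word n) → length π ≡ n → Unique π → ∀ k → k ≤ n →
    fpow k (canon π) ∈ perms n × ∃ λ cs → fpow k (canon π) ≡ Fin.zero ∷ cs
  fpow-canon-permutation π len uπ k k≤n = ∈-perms _ c-length c-unique , proj₁ shape , trans c≡ (proj₂ shape)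
    where
    rotated-length : length (rotateBy k π) ≡ n
    rotated-length = trans (length-rotateBy k π) len
    c≡ : fpow k (canon π) ≡ canon (rotateBy k π)
    c≡ = fpow-canon k π (subst (k ≤_) (sym len) k≤n)
    shape : ∃ λ cs → canon (rotateBy k π) ≡ Fin.zero ∷ cs
    shape = canon-nonempty (rotateBy k π) (subst (0 <_) (sym rotated-length) (s≤s z≤n))
    c-length : length (fpow k (canon π)) ≡ n
    c-length = trans (cong length c≡) (trans (length-canon (rotateBy k π)) rotated-length)
    c-unique : Unique (fpow k (canon π))
    c-unique = subst Unique (sym c≡) (Unique-canon (Unique-rotateBy k uπ))

  -- Overlapping concatenation

  lastOr : Fin n → Word n → Fin n
  lastOr a [] = a
  lastOr a (x ∷ xs) = lastOr x xs

  lastOr-∷ : ∀ a (xs : Word n) → ∃ λ p → a ∷ xs ≡ p ++ [ lastOr a xs ]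
  lastOr-∷ a [] = [] , refl
  lastOr-∷ a (x ∷ xs) with lastOr-∷ x xs
  ... | p , eq = a ∷ p , cong (a ∷_) eq

  -- glue a ws continues a word ending in the letter a: each word of ws, meant to begin
  -- with 0, is shifted to begin with the current last letter and appended without it.
  glue : Fin n → List (Word n) → Word n
  glue a [] = []
  glue a ([] ∷ ws) = glue a ws
  glue a ((_ ∷ xs) ∷ ws) = shiftWord (toℕ a) xs ++ glue (lastOr a (shiftWord (toℕ a) xs)) ws

  length-glue : ∀ a (ws : List (Word n)) → length (glue a ws) ≡ sum (map (λ w → length w ∸ 1) ws)
  length-glue a [] = refl
  length-glue a ([] ∷ ws) = length-glue a ws
  length-glue a ((_ ∷ xs) ∷ ws) =
    trans (length-++ (shiftWord (toℕ a) xs)) (cong₂ _+_ (length-shiftWord (toℕ a) xs) (length-glue _ ws))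

  glue-factor : ∀ (ws : List (Word n)) {xs} → Fin.zero ∷ xs ∈ ws → ∀ a₀ →
    ∃ λ i → ∃ λ (a : Fin n) → ∃ λ rest → drop i (a₀ ∷ glue a₀ ws) ≡ shiftWord (toℕ a) (Fin.zero ∷ xs) ++ rest
  glue-factor ((_ ∷ xs) ∷ ws) (here refl) a₀ =
    0 , a₀ , glue (lastOr a₀ (shiftWord (toℕ a₀) xs)) ws , cong (_∷ shiftWord (toℕ a₀) xs ++ glue (lastOr a₀ (shiftWord (toℕ a₀) xs)) ws) (sym (shift-toℕ a₀))
  glue-factor ([] ∷ ws) (there x∈) a₀ = glue-factor ws x∈ a₀
  glue-factor ((_ ∷ ys) ∷ ws) (there x∈) a₀ with glue-factor ws x∈ (lastOr a₀ (shiftWord (toℕ a₀) ys)) | lastOr-∷ a₀ (shiftWord (toℕ a₀) ys)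
  ... | i , a , rest , at-i | p , split = length p + i , a , rest , (begin
    drop (length p + i) (a₀ ∷ ys′ ++ glue b ws)           ≡⟨ drop-drop (length p) i _ ⟨
    drop i (drop (length p) ((a₀ ∷ ys′) ++ glue b ws))    ≡⟨ cong (λ v → drop i (drop (length p) (v ++ glue b ws))) split ⟩
    drop i (drop (length p) ((p ++ [ b ]) ++ glue b ws))  ≡⟨ cong (λ v → drop i (drop (length p) v)) (++-assoc p [ b ] (glue b ws)) ⟩
    drop i (drop (length p) (p ++ b ∷ glue b ws))         ≡⟨ cong (drop i) (drop-length-++ p (b ∷ glue b ws)) ⟩
    drop i (b ∷ glue b ws)                                ≡⟨ at-i ⟩
    shiftWord (toℕ a) (Fin.zero ∷ _) ++ rest              ∎)
    where
    open ≡-Reasoning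
    ys′ = shiftWord (toℕ a₀) ys
    b = lastOr a₀ ys′

-- The universal word

module _ (m : ℕ) where

  private
    n : ℕ
    n = suc m

  leaders : ℕ → List (Word n)
  leaders D = filterᵇ (cycleLeaderᵇ D) (perms n)

  cycleLeaderᵇ-intro : ∀ d (cs : Word n) → IsCycleLeader (suc d) (Fin.zero ∷ cs) → T (cycleLeaderᵇ (suc d) (Fin.zero ∷ cs))
  cycleLeaderᵇ-intro d cs (isCycleLeader (isLeastPeriod periodic aperiodic) minimal) =
    ∧-intro tt (∧-intro (T-== periodic) (∧-intro
      (all⁻ _ (applyUpTo⁺₁ id d λ j<d → T-not-== (aperiodic _ (s≤s j<d))))
      (all⁻ _ (applyUpTo⁺₁ id d λ {j} _ → ≼⇒lexLeq (minimal (suc j))))))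
    where
    ∧-intro : ∀ {a b} → T a → T b → T (a ∧ b)
    ∧-intro ta tb = Equivalence.from T-∧ (ta , tb)

  leader-shape : ∀ {D c} → c ∈ leaders D → length c ≡ n × ∃ λ cs → c ≡ Fin.zero ∷ cs
  leader-shape {D} {c} c∈ with ∈-filter⁻ (T? ∘ cycleLeaderᵇ D) c∈
  ... | c∈perms , leader = perms-length c∈perms , isCanonᵇ⇒ c (proj₁ (Equivalence.to T-∧ leader))

  ∈-leaders : ∀ {d} {c : Word n} cs → c ∈ perms n → c ≡ Fin.zero ∷ cs → IsCycleLeader (suc d) c → c ∈ leaders (suc d)
  ∈-leaders {d} cs c∈perms refl leader = ∈-filter⁺ (T? ∘ cycleLeaderᵇ (suc d)) c∈perms (cycleLeaderᵇ-intro d cs leader)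

  class-leader : ∀ (π : Word n) → length π ≡ n → Unique π →
    ∃ λ d → suc d ∈ divisors n × ∃ λ c → c ∈ leaders (suc d) × ∃ λ j → j ≤ d × fpow j c ≡ canon π
  class-leader π len uπ =
    let periodic = fpow-length-canon π len
        d , d≤m , least = ∃-leastPeriod m (canon π) periodic
        i , i≤d , leader = cycleLeader-in-orbit least
        c∈perms , cs , c≡ = fpow-canon-permutation π len uπ i (m≤n⇒m≤1+n (≤-trans i≤d d≤m))
        j , j≤d , returns = orbit-return (IsLeastPeriod.periodic least) i (m≤n⇒m≤1+n i≤d)
    in d , ∈-divisors d (leastPeriod-∣ least n periodic) (s≤s d≤m) ,
       fpow i (canon π) , ∈-leaders cs c∈perms c≡ leader , j , j≤d , returns

  block : ℕ → Word n → Word n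
  block D c = c ++ take (D ∸ 1) c

  cycleBlocks : ℕ → List (Word n)
  cycleBlocks D = map (block D) (leaders D)

  blocks : List (Word n)
  blocks = concatMap cycleBlocks (divisors n)

  u : Word n
  u = Fin.zero ∷ glue Fin.zero blocks

  length-block : ∀ d (c : Word n) → length c ≡ n → length (block (suc d) c) ≡ n + d ⊓ n
  length-block d c len = trans (length-++ c) (cong₂ _+_ len (trans (length-take d c) (cong (d ⊓_) len)))

  block-window : ∀ d j (c : Word n) → length c ≡ n → j ≤ d → d < n → take n (drop j (block (suc d) c)) ≡ rotateBy j c
  block-window d j c len j≤d d<n = begin
    take n (drop j (c ++ take d c))           ≡⟨ cong (λ l → take l (drop j (c ++ take d c))) len ⟨
    take (length c) (drop j (c ++ take d c))  ≡⟨ take-length-drop-++ j c (take d c) (subst (j ≤_) (sym len) (<⇒≤ (≤-<-trans j≤d d<n))) ⟩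
    drop j c ++ take j (take d c)             ≡⟨ cong (drop j c ++_) (take-take j d c) ⟩
    drop j c ++ take (j ⊓ d) c                ≡⟨ cong (λ l → drop j c ++ take l c) (m≤n⇒m⊓n≡m j≤d) ⟩
    rotateBy j c                              ∎
    where open ≡-Reasoning

  window-fits : ∀ d j (c : Word n) a → length c ≡ n → j ≤ d → d < n → j + n ≤ length (shiftWord a (block (suc d) c))
  window-fits d j c a len j≤d d<n = begin
    j + n        ≤⟨ +-monoˡ-≤ n j≤d ⟩
    d + n        ≡⟨ +-comm d n ⟩
    n + d        ≡⟨ cong (n +_) (m≤n⇒m⊓n≡m (<⇒≤ d<n)) ⟨
    n + d ⊓ n    ≡⟨ trans (length-shiftWord a (block (suc d) c)) (length-block d c len) ⟨
    length (shiftWord a (block (suc d) c)) ∎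
    where open ≤-Reasoning

  -- The windows of the block of c are the rotations of c, whose classes are the f-iterates of c.
  leader-windows : ∀ {d c} → suc d ∈ divisors n → c ∈ leaders (suc d) → ∀ j → j ≤ d →
    ∃ λ i → canon (take n (drop i u)) ≡ fpow j c
  leader-windows {d} {c} D∈ c∈ j j≤d with leader-shape {suc d} c∈ | ∈-divisors⁻ {n} D∈
  ... | len , cs , refl | _ , refl , d<n with glue-factor blocks block∈ Fin.zero
    where
    block∈ : block (suc d) (Fin.zero ∷ cs) ∈ blocks
    block∈ = ∈-concat⁺′ (∈-map⁺ (block (suc d)) c∈) (∈-map⁺ cycleBlocks D∈)
  ... | i , a , rest , u-at-i = i + j , (begin
    canon (take n (drop (i + j) u))                      ≡⟨ cong (canon ∘ take n) (drop-drop i j u) ⟨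
    canon (take n (drop j (drop i u)))                   ≡⟨ cong (λ v → canon (take n (drop j v))) u-at-i ⟩
    canon (take n (drop j (shiftWord (toℕ a) blk ++ rest)))
      ≡⟨ cong canon (take-drop-++ˡ j n (shiftWord (toℕ a) blk) rest (window-fits d j c (toℕ a) len j≤d d<n)) ⟩
    canon (take n (drop j (shiftWord (toℕ a) blk)))      ≡⟨ cong (canon ∘ take n) (drop-map j blk) ⟩
    canon (take n (shiftWord (toℕ a) (drop j blk)))      ≡⟨ cong canon (take-map n (drop j blk)) ⟩
    canon (shiftWord (toℕ a) (take n (drop j blk)))      ≡⟨ canon-shiftWord (toℕ a) (take n (drop j blk)) ⟩
    canon (take n (drop j blk))                          ≡⟨ cong canon (block-window d j c len j≤d d<n) ⟩
    canon (rotateBy j c)                                 ≡⟨ fpow-canon j c (subst (j ≤_) (sym len) (<⇒≤ (≤-<-trans j≤d d<n))) ⟨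
    fpow j (canon c)                                     ≡⟨ cong (fpow j) (canon-zero∷ cs) ⟩
    fpow j c                                             ∎)
    where
    open ≡-Reasoning
    blk = block (suc d) c

  block-cost : ∀ d (c : Word n) → length c ≡ n → length (block (suc d) c) ∸ 1 ≤ suc d + n ∸ 2
  block-cost d c len = begin
    length (block (suc d) c) ∸ 1   ≡⟨ cong (_∸ 1) (length-block d c len) ⟩
    m + d ⊓ n                      ≤⟨ +-monoʳ-≤ m (m⊓n≤m d n) ⟩
    m + d                          ≡⟨ +-comm m d ⟩
    d + m                          ≡⟨ cong (_∸ 1) (+-suc d m) ⟨
    suc d + n ∸ 2                  ∎
    where open ≤-Reasoning

  leaders-cost : ∀ d → sum (map (λ w → length w ∸ 1) (cycleBlocks (suc d)))
                       ≤ cycles1 n (suc d) * (suc d + n ∸ 2)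
  leaders-cost d = subst (_≤ cycles1 n (suc d) * (suc d + n ∸ 2)) (cong sum (map-∘ (leaders (suc d))))
    (sum-map-≤ (λ c → length (block (suc d) c) ∸ 1) (suc d + n ∸ 2) (leaders (suc d))
      λ c c∈ → block-cost d c (proj₁ (leader-shape {suc d} c∈)))

  blocks-cost : ∀ Ds → (∀ {D} → D ∈ Ds → 0 < D) →
    sum (map (λ w → length w ∸ 1) (concatMap cycleBlocks Ds))
      ≤ sum (map (λ D → cycles1 n D * (D + n ∸ 2)) Ds)
  blocks-cost [] _ = z≤n
  blocks-cost (zero ∷ Ds) pos = ⊥-elim (<-irrefl refl (pos (here refl)))
  blocks-cost (suc d ∷ Ds) pos = begin
    sum (map cost (bs ++ rest))               ≡⟨ cong sum (map-++ cost bs rest) ⟩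
    sum (map cost bs ++ map cost rest)        ≡⟨ sum-++ (map cost bs) (map cost rest) ⟩
    sum (map cost bs) + sum (map cost rest)   ≤⟨ +-mono-≤ (leaders-cost d) (blocks-cost Ds (pos ∘ there)) ⟩
    sum (map (λ D → cycles1 n D * (D + n ∸ 2)) (suc d ∷ Ds)) ∎
    where
    open ≤-Reasoning
    cost : Word n → ℕ
    cost w = length w ∸ 1
    bs = cycleBlocks (suc d)
    rest = concatMap cycleBlocks Ds

  length-u : length u ≤ B n
  length-u = s≤s (≤-trans (≤-reflexive (length-glue Fin.zero blocks)) (blocks-cost (divisors n) divisor-pos))
    where
    divisor-pos : ∀ {D} → D ∈ divisors n → 0 < D
    divisor-pos D∈ with ∈-divisors⁻ {n} D∈
    ... | _ , refl , _ = s≤s z≤n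

  universal : Universal n u
  universal π len uπ =
    let d , D∈ , c , c∈ , j , j≤d , returns = class-leader π len uπ
        i , window = leader-windows D∈ c∈ j j≤d
    in i , canon-≡⇒shiftWord (take n (drop i u)) π (trans window returns)

theorem5 : (n : ℕ) → 1 ≤ n → ∃ λ u → Universal n u × length u ≤ B n
theorem5 (suc m) _ = u m , universal m , length-u m
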